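{- Let $n\ge 3$. For any $\pi_1,\pi_2\in S_n$, $G_{\pi_1}$ and $G_{\pi_2}$ are isomorphic if, and only if, $\pi_1$ and $\pi_2$ are conjugate in $S_n$.
   Context: $S_n$ is the symmetric group on $\{1,\dots,n\}$. Fix disjoint vertex sets $A=\{a_1,\dots,a_n\}$, $B=\{b_1,\dots,b_n\}$, $C=\{c_1,\dots,c_n\}$, $D=\{d_1,\dots,d_n\}$. For $\pi\in S_n$, $G^-_\pi$ is the graph on $A\cup B\cup C\cup D$ with edges $\{a_i,b_j\}$ ($i\ne j$), $\{b_i,c_i\}$ (all $i$), $\{c_i,d_j\}$ ($i\ne j$), and $\{a_i,d_{\pi(i)}\}$ (all $i$). $G_\pi$ is obtained from $G^-_\pi$ by adding three new vertices $e,f,g$ with neighbourhoods $N(e)=B\cup D\cup\{f,g\}$, $N(f)=A\cup C\cup\{e\}$, $N(g)=C\cup\{e\}$. -}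

module Defs where

open import Data.Nat using (ℕ)
open import Data.Fin using (Fin)
open import Data.Fin.Permutation using (Permutation′; _⟨$⟩ʳ_)
open import Data.Product using (Σ; _×_)
open import Data.Sum using (_⊎_)
open import Relation.Binary.PropositionalEquality using (_≡_)
open import Relation.Nullary using (¬_)
open import Function.Bundles using (_↔_; _⇔_; Inverse)

data Vertex (n : ℕ) : Set where
  a b c d : Fin n → Vertex n
  e f g : Vertex n

-- One orientation of each edge of G_π (the edge set listed in the paper).
data Edge {n : ℕ} (π : Permutation′ n) : Vertex n → Vertex n → Set where
  ab : ∀ {i j} → ¬ i ≡ j → Edge π (a i) (b j)
  bc : ∀ {i} → Edge π (b i) (c i)
  cd : ∀ {i j} → ¬ i ≡ j → Edge π (c i) (d j)
  ad : ∀ {i} → Edge π (a i) (d (π ⟨$⟩ʳ i))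
  eb : ∀ {i} → Edge π e (b i)
  ed : ∀ {i} → Edge π e (d i)
  ef : Edge π e f
  eg : Edge π e g
  fa : ∀ {i} → Edge π f (a i)
  fc : ∀ {i} → Edge π f (c i)
  gc : ∀ {i} → Edge π g (c i)

Adj : ∀ {n} → Permutation′ n → Vertex n → Vertex n → Set
Adj π u v = Edge π u v ⊎ Edge π v u

Isomorphic : ∀ {n} → Permutation′ n → Permutation′ n → Set
Isomorphic {n} π₁ π₂ =
  Σ (Vertex n ↔ Vertex n) λ φ →
    ∀ u v → Adj π₁ u v ⇔ Adj π₂ (Inverse.to φ u) (Inverse.to φ v)

-- π₁ and π₂ conjugate in S_n: π₂ = σ π₁ σ⁻¹ for some σ, i.e. π₂ ∘ σ = σ ∘ π₁.
Conjugate : ∀ {n} → Permutation′ n → Permutation′ n → Set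
Conjugate {n} π₁ π₂ =
  Σ (Permutation′ n) λ σ → ∀ i → π₂ ⟨$⟩ʳ (σ ⟨$⟩ʳ i) ≡ σ ⟨$⟩ʳ (π₁ ⟨$⟩ʳ i)

{-# OPTIONS --safe #-}
module Submission where

-- {e, f} is the only dominating pair of G_π, and deg e = 2n + 2 > 2n + 1 = deg f, so every
-- isomorphism fixes e and f. Since deg c_i = n + 2 > n + 1 = deg a_k, it then maps C onto C and
-- hence A onto A. It maps B onto B because b_i has n − 1 ≥ 2 neighbours in A while a vertex of D
-- has only one; dually D onto D. The non-edges a_i b_i, c_i d_i and the edges b_i c_i force one
-- index map α on all four classes, and the edges a_i d_{π(i)} say that α conjugates π₁ into π₂.
-- Conversely, relabelling all indices by a conjugating permutation is an isomorphism.

open import Defs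
open import Data.Bool using (Bool; true; false; not)
open import Data.Bool.Properties using (not-involutive; not-injective; not-¬)
open import Data.Fin using (Fin; zero; suc; _↑ˡ_; _↑ʳ_; splitAt; punchIn)
open import Data.Fin.Properties
  using (_≟_; 0≢1+n; splitAt-↑ˡ; splitAt-↑ʳ; join-splitAt; punchIn-injective; punchInᵢ≢i)
  using (injective⇒≤)
open import Data.Fin.Permutation
  using (Permutation′; _⟨$⟩ʳ_; _⟨$⟩ˡ_; inverseˡ; inverseʳ; permutation; flip)
open import Data.Nat using (ℕ; _+_; _≤_; _≥_; z≤n; s≤s)
open import Data.Nat.Properties using (1+n≰n)
open import Data.Product using (_×_; _,_; proj₁; proj₂; ∃-syntax; ∃₂)
import Data.Product as Product
open import Data.Sum using (_⊎_; inj₁; inj₂; [_,_]′)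
import Data.Sum as Sum
open import Data.Empty using (⊥-elim)
open import Function using (_∘_; id)
open import Function.Bundles using (_↔_; _⇔_; Inverse; Injection; Equivalence; mk⇔; mk↔ₛ′)
open import Function.Construct.Symmetry using (↔-sym)
open import Function.Definitions using (Injective)
open import Function.Properties.Inverse using (↔⇒↣)
open import Level using (0ℓ)
open import Relation.Binary.Core using (Rel)
open import Relation.Binary.PropositionalEquality
open import Relation.Nullary using (¬_; yes; no)
open import Relation.Nullary.Decidable using (decidable-stable)
open import Relation.Nullary.Negation using (contradiction)

record IsIsomorphism {V W : Set} (R : Rel V 0ℓ) (S : Rel W 0ℓ) (φ : V ↔ W) : Set where
  field
    adjacency : ∀ u v → R u v ⇔ S (Inverse.to φ u) (Inverse.to φ v)

isIsomorphism : {V W : Set} {R : Rel V 0ℓ} {S : Rel W 0ℓ} (φ : V ↔ W) →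
  (∀ {u v} → R u v → S (Inverse.to φ u) (Inverse.to φ v)) →
  (∀ {u v} → S u v → R (Inverse.from φ u) (Inverse.from φ v)) →
  IsIsomorphism R S φ
isIsomorphism {R = R} φ preserves reflects .IsIsomorphism.adjacency u v =
  mk⇔ preserves λ h → subst₂ R (strictlyInverseʳ u) (strictlyInverseʳ v) (reflects h)
  where open Inverse φ

record Dominating {V : Set} (R : Rel V 0ℓ) (x y : V) : Set where
  field
    dominates : ∀ z → R x z ⊎ R y z

open Dominating

module _ {V : Set} {R : Rel V 0ℓ} {x y : V} where

  dominating-sym : Dominating R x y → Dominating R y x
  dominating-sym D .dominates = Sum.swap ∘ dominates D

  dominated-by-other : Dominating R x y → ∀ z → ¬ R x z → R y z
  dominated-by-other D z ¬xz = [ ⊥-elim ∘ ¬xz , id ]′ (dominates D z)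

-- Degree bounds are witnessed by split injections Fin k → N(x) and N(x) → Fin m.
record Degree≥ {V : Set} (R : Rel V 0ℓ) (x : V) (k : ℕ) : Set where
  field
    neighbour          : Fin k → V
    neighbour-adjacent : ∀ i → R x (neighbour i)
    position           : V → Fin k
    position-neighbour : ∀ i → position (neighbour i) ≡ i

record Degree≤ {V : Set} (R : Rel V 0ℓ) (x : V) (m : ℕ) : Set where
  field
    index        : V → Fin m
    decode       : Fin m → V
    decode-index : ∀ {u} → R x u → decode (index u) ≡ u

open Degree≥
open Degree≤

degree-≤ : {V : Set} {R : Rel V 0ℓ} {x : V} {k m : ℕ} → Degree≥ R x k → Degree≤ R x m → k ≤ m
degree-≤ lower upper = injective⇒≤ λ {i} {j} eq → begin
  i                                                   ≡⟨ sym (position-neighbour lower i) ⟩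
  position lower (neighbour lower i)                  ≡⟨ cong (position lower) (sym (retract i)) ⟩
  position lower (decode upper (index upper (neighbour lower i)))
    ≡⟨ cong (position lower ∘ decode upper) eq ⟩
  position lower (decode upper (index upper (neighbour lower j)))
    ≡⟨ cong (position lower) (retract j) ⟩
  position lower (neighbour lower j)                  ≡⟨ position-neighbour lower j ⟩
  j                                                   ∎
  where
    open ≡-Reasoning
    retract : ∀ i → decode upper (index upper (neighbour lower i)) ≡ neighbour lower i
    retract i = decode-index upper (neighbour-adjacent lower i)

module Isomorphism {V W : Set} {R : Rel V 0ℓ} {S : Rel W 0ℓ} {φ : V ↔ W}
                   (iso : IsIsomorphism R S φ) where

  open Inverse φ public using (to; from; strictlyInverseˡ; strictlyInverseʳ)

  to-injective : Injective _≡_ _≡_ to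
  to-injective = Injection.injective (↔⇒↣ φ)

  preserves : ∀ {u v} → R u v → S (to u) (to v)
  preserves = Equivalence.to (IsIsomorphism.adjacency iso _ _)

  preserves-at : ∀ {u v u′ v′} → to u ≡ u′ → to v ≡ v′ → R u v → S u′ v′
  preserves-at refl refl = preserves

  reflects-at : ∀ {u v u′ v′} → to u ≡ u′ → to v ≡ v′ → S u′ v′ → R u v
  reflects-at refl refl = Equivalence.from (IsIsomorphism.adjacency iso _ _)

  from-to : ∀ {u v} → to u ≡ v → from v ≡ u
  from-to {u} refl = strictlyInverseʳ u

  to-from : ∀ {u v} → from v ≡ u → to u ≡ v
  to-from {v = v} refl = strictlyInverseˡ v

  preimage-unique : ∀ {u x y} → to u ≡ y → to x ≡ y → u ≡ x
  preimage-unique p q = to-injective (trans p (sym q))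

  inverse : IsIsomorphism S R (↔-sym φ)
  inverse =
    isIsomorphism (↔-sym φ) (reflects-at (strictlyInverseˡ _) (strictlyInverseˡ _)) preserves

  dominating : ∀ {x y} → Dominating R x y → Dominating S (to x) (to y)
  dominating D .dominates z = Sum.map move move (dominates D (from z))
    where
      move : ∀ {w} → R w (from z) → S (to w) z
      move h = subst (S _) (strictlyInverseˡ z) (preserves h)

  degree≥ : ∀ {x k} → Degree≥ R x k → Degree≥ S (to x) k
  degree≥ lower .neighbour            = to ∘ neighbour lower
  degree≥ lower .neighbour-adjacent i = preserves (neighbour-adjacent lower i)
  degree≥ lower .position             = position lower ∘ from
  degree≥ lower .position-neighbour i =
    trans (cong (position lower) (strictlyInverseʳ _)) (position-neighbour lower i)

  degree-bounded : ∀ {x y k m} → Degree≥ R x k → Degree≤ S y m → to x ≡ y → k ≤ m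
  degree-bounded lower upper refl = degree-≤ (degree≥ lower) upper

distinct-others : ∀ {n} (i : Fin (3 + n)) → ∃₂ λ j k → j ≢ k × j ≢ i × k ≢ i
distinct-others i =
  punchIn i zero , punchIn i (suc zero) ,
  0≢1+n ∘ punchIn-injective i zero (suc zero) ,
  punchInᵢ≢i i zero , punchInᵢ≢i i (suc zero)

module _ {n : ℕ} {π : Permutation′ n} where

  colour : Vertex n → Bool
  colour (a _) = true
  colour (b _) = false
  colour (c _) = true
  colour (d _) = false
  colour e     = true
  colour f     = false
  colour g     = false

  edge-colour : ∀ {u v} → Edge π u v → colour u ≡ not (colour v)
  edge-colour (ab _) = refl
  edge-colour bc     = refl
  edge-colour (cd _) = refl
  edge-colour ad     = refl
  edge-colour eb     = refl
  edge-colour ed     = refl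
  edge-colour ef     = refl
  edge-colour eg     = refl
  edge-colour fa     = refl
  edge-colour fc     = refl
  edge-colour gc     = refl

  adjacent-colour : ∀ {u v} → Adj π u v → colour u ≡ not (colour v)
  adjacent-colour (inj₁ uv) = edge-colour uv
  adjacent-colour (inj₂ vu) = trans (sym (not-involutive _)) (cong not (sym (edge-colour vu)))

  monochromatic-nonadjacent : ∀ {u v} → colour u ≡ colour v → ¬ Adj π u v
  monochromatic-nonadjacent same uv = not-¬ same (adjacent-colour uv)

  common-neighbour-colour : ∀ {u v w} → Adj π w u → Adj π w v → colour u ≡ colour v
  common-neighbour-colour wu wv =
    not-injective (trans (sym (adjacent-colour wu)) (adjacent-colour wv))

  a≁b : ∀ {i} → ¬ Adj π (a i) (b i)
  a≁b (inj₁ (ab i≢i)) = i≢i refl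
  a≁b (inj₂ ())

  c≁d : ∀ {i} → ¬ Adj π (c i) (d i)
  c≁d (inj₁ (cd i≢i)) = i≢i refl
  c≁d (inj₂ ())

  g≁a : ∀ {i} → ¬ Adj π g (a i)
  g≁a (inj₁ ())
  g≁a (inj₂ ())

  a-d-adjacent : ∀ {i j} → Adj π (a i) (d j) → π ⟨$⟩ʳ i ≡ j
  a-d-adjacent (inj₁ ad) = refl
  a-d-adjacent (inj₂ ())

  b-c-adjacent : ∀ {i j} → Adj π (b i) (c j) → i ≡ j
  b-c-adjacent (inj₁ bc) = refl
  b-c-adjacent (inj₂ ())

  unique-a-neighbour : ∀ {i j m} → Adj π (a i) (d m) → Adj π (a j) (d m) → i ≡ j
  unique-a-neighbour h h′ =
    Injection.injective (↔⇒↣ π) (trans (a-d-adjacent h) (sym (a-d-adjacent h′)))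

  unique-c-neighbour : ∀ {i j m} → Adj π (c i) (b m) → Adj π (c j) (b m) → i ≡ j
  unique-c-neighbour h h′ = trans (sym (b-c-adjacent (Sum.swap h))) (b-c-adjacent (Sum.swap h′))

  a-neighbour-of-d : ∀ i → Adj π (a (π ⟨$⟩ˡ i)) (d i)
  a-neighbour-of-d i = subst (λ j → Adj π (a (π ⟨$⟩ˡ i)) (d j)) (inverseʳ π) (inj₁ ad)

  neighbour-of-e : ∀ {u} → Adj π e u → u ≡ f ⊎ u ≡ g ⊎ (∃[ j ] u ≡ b j) ⊎ (∃[ j ] u ≡ d j)
  neighbour-of-e (inj₁ ef) = inj₁ refl
  neighbour-of-e (inj₁ eg) = inj₂ (inj₁ refl)
  neighbour-of-e (inj₁ eb) = inj₂ (inj₂ (inj₁ (_ , refl)))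
  neighbour-of-e (inj₁ ed) = inj₂ (inj₂ (inj₂ (_ , refl)))

  neighbour-of-f : ∀ {u} → Adj π f u → u ≡ e ⊎ (∃[ j ] u ≡ a j) ⊎ (∃[ j ] u ≡ c j)
  neighbour-of-f (inj₂ ef) = inj₁ refl
  neighbour-of-f (inj₁ fa) = inj₂ (inj₁ (_ , refl))
  neighbour-of-f (inj₁ fc) = inj₂ (inj₂ (_ , refl))

  e-f-dominating : Dominating (Adj π) e f
  e-f-dominating .dominates (a _) = inj₂ (inj₁ fa)
  e-f-dominating .dominates (b _) = inj₁ (inj₁ eb)
  e-f-dominating .dominates (c _) = inj₂ (inj₁ fc)
  e-f-dominating .dominates (d _) = inj₁ (inj₁ ed)
  e-f-dominating .dominates e     = inj₂ (inj₂ ef)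
  e-f-dominating .dominates f     = inj₁ (inj₁ ef)
  e-f-dominating .dominates g     = inj₁ (inj₁ eg)

  -- x ∈ N(g) = C ∪ {e}. If x = c_i, then y is a common neighbour of c_i and d_i, which have
  -- different colours; if x = e, then y ∈ N(a_i) = {f} ∪ B ∖ {b_i} ∪ {d_{π i}}.
  dominating-via-g : ∀ {x y} → Fin n → Adj π x g → Dominating (Adj π) x y → x ≡ e × y ≡ f
  dominating-via-g i (inj₁ eg) D
    with dominated-by-other D (a i) (monochromatic-nonadjacent refl)
  ... | inj₁ fa = refl , refl
  ... | inj₂ (ab {j = j} _) =
    ⊥-elim (a≁b (Sum.swap (dominated-by-other D (a j) (monochromatic-nonadjacent refl))))
  ... | inj₂ ad =
    ⊥-elim (c≁d (Sum.swap
      (dominated-by-other D (c (π ⟨$⟩ʳ i)) (monochromatic-nonadjacent refl))))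
  dominating-via-g _ (inj₂ (gc {i})) D = contradiction (common-neighbour-colour y~c y~d) λ ()
    where
      y~c = dominated-by-other D (c i) (monochromatic-nonadjacent refl)
      y~d = dominated-by-other D (d i) c≁d

  dominating-pair : ∀ {x y} → Fin n → Dominating (Adj π) x y →
                    (x ≡ e × y ≡ f) ⊎ (x ≡ f × y ≡ e)
  dominating-pair i D with dominates D g
  ... | inj₁ x~g = inj₁ (dominating-via-g i x~g D)
  ... | inj₂ y~g = inj₂ (Product.swap (dominating-via-g i y~g (dominating-sym D)))

  e-degree≥ : Degree≥ (Adj π) e (2 + (n + n))
  e-degree≥ .neighbour zero                = f
  e-degree≥ .neighbour (suc zero)          = g
  e-degree≥ .neighbour (suc (suc k))       = [ b , d ]′ (splitAt n k)
  e-degree≥ .neighbour-adjacent zero       = inj₁ ef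
  e-degree≥ .neighbour-adjacent (suc zero) = inj₁ eg
  e-degree≥ .neighbour-adjacent (suc (suc k)) with splitAt n k
  ... | inj₁ _ = inj₁ eb
  ... | inj₂ _ = inj₁ ed
  e-degree≥ .position (b i) = suc (suc (i ↑ˡ n))
  e-degree≥ .position (d i) = suc (suc (n ↑ʳ i))
  e-degree≥ .position g     = suc zero
  e-degree≥ .position _     = zero
  e-degree≥ .position-neighbour zero       = refl
  e-degree≥ .position-neighbour (suc zero) = refl
  e-degree≥ .position-neighbour (suc (suc k)) with splitAt n k | join-splitAt n n k
  ... | inj₁ _ | joined = cong (suc ∘ suc) joined
  ... | inj₂ _ | joined = cong (suc ∘ suc) joined

  f-degree≤ : Degree≤ (Adj π) f (1 + (n + n))
  f-degree≤ .index (a i)     = suc (i ↑ˡ n)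
  f-degree≤ .index (c i)     = suc (n ↑ʳ i)
  f-degree≤ .index _         = zero
  f-degree≤ .decode zero     = e
  f-degree≤ .decode (suc k)  = [ a , c ]′ (splitAt n k)
  f-degree≤ .decode-index (inj₁ (fa {i})) = cong [ a , c ]′ (splitAt-↑ˡ n i n)
  f-degree≤ .decode-index (inj₁ (fc {i})) = cong [ a , c ]′ (splitAt-↑ʳ n n i)
  f-degree≤ .decode-index (inj₂ ef)       = refl

  -- Besides f and g, c_i has exactly one neighbour in each column {b_j, d_j}: b_i for j = i, else d_j.
  c-degree≥ : ∀ i → Degree≥ (Adj π) (c i) (2 + n)
  c-degree≥ i .neighbour zero       = f
  c-degree≥ i .neighbour (suc zero) = g
  c-degree≥ i .neighbour (suc (suc j)) with j ≟ i
  ... | yes _ = b i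
  ... | no _  = d j
  c-degree≥ i .neighbour-adjacent zero       = inj₂ fc
  c-degree≥ i .neighbour-adjacent (suc zero) = inj₂ gc
  c-degree≥ i .neighbour-adjacent (suc (suc j)) with j ≟ i
  ... | yes _   = inj₂ bc
  ... | no j≢i  = inj₁ (cd (j≢i ∘ sym))
  c-degree≥ i .position (b _) = suc (suc i)
  c-degree≥ i .position (d j) = suc (suc j)
  c-degree≥ i .position g     = suc zero
  c-degree≥ i .position _     = zero
  c-degree≥ i .position-neighbour zero       = refl
  c-degree≥ i .position-neighbour (suc zero) = refl
  c-degree≥ i .position-neighbour (suc (suc j)) with j ≟ i
  ... | yes j≡i = cong (suc ∘ suc) (sym j≡i)
  ... | no _    = refl

  a-degree≤ : ∀ i → Degree≤ (Adj π) (a i) (1 + n)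
  a-degree≤ i .index f     = zero
  a-degree≤ i .index (b j) = suc j
  a-degree≤ i .index _     = suc i
  a-degree≤ i .decode zero = f
  a-degree≤ i .decode (suc j) with j ≟ i
  ... | yes _ = d (π ⟨$⟩ʳ i)
  ... | no _  = b j
  a-degree≤ i .decode-index (inj₂ fa) = refl
  a-degree≤ i .decode-index (inj₁ (ab {j = j} i≢j)) with j ≟ i
  ... | yes j≡i = contradiction (sym j≡i) i≢j
  ... | no _    = refl
  a-degree≤ i .decode-index (inj₁ ad) with i ≟ i
  ... | yes _   = refl
  ... | no i≢i  = contradiction refl i≢i

module _ {n : ℕ} {π π′ : Permutation′ n} {φ : Vertex n ↔ Vertex n}
         (iso : IsIsomorphism (Adj π) (Adj π′) φ) where

  open Isomorphism iso

  hubs-fixed : Fin n → to e ≡ e × to f ≡ f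
  hubs-fixed i with dominating-pair i (dominating e-f-dominating)
  ... | inj₁ fixed    = fixed
  ... | inj₂ (e↦f , _) = contradiction (degree-bounded e-degree≥ f-degree≤ e↦f) 1+n≰n

  c↦c : to e ≡ e → to f ≡ f → ∀ i → ∃[ j ] to (c i) ≡ c j
  c↦c e-fixed f-fixed i with neighbour-of-f (preserves-at f-fixed refl (inj₁ fc))
  ... | inj₁ c↦e with preimage-unique c↦e e-fixed
  ...   | ()
  c↦c e-fixed f-fixed i | inj₂ (inj₁ (k , c↦a)) =
    contradiction (degree-bounded (c-degree≥ i) (a-degree≤ k) c↦a) 1+n≰n
  c↦c e-fixed f-fixed i | inj₂ (inj₂ c↦c′) = c↦c′

a-injective : ∀ {n} {i j : Fin n} → a i ≡ a j → i ≡ j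
a-injective refl = refl

c-injective : ∀ {n} {i j : Fin n} → c i ≡ c j → i ≡ j
c-injective refl = refl

module IndexMaps {n : ℕ} {π π′ : Permutation′ (3 + n)} {φ : Vertex (3 + n) ↔ Vertex (3 + n)}
                 (iso : IsIsomorphism (Adj π) (Adj π′) φ)
                 (e-fixed : Inverse.to φ e ≡ e) (f-fixed : Inverse.to φ f ≡ f) where

  open Isomorphism iso

  a↦a : ∀ i → ∃[ j ] to (a i) ≡ a j
  a↦a i with neighbour-of-f (preserves-at f-fixed refl (inj₁ fa))
  ... | inj₁ a↦e with preimage-unique a↦e e-fixed
  ...   | ()
  a↦a i | inj₂ (inj₁ a↦a′) = a↦a′
  a↦a i | inj₂ (inj₂ (k , a↦c)) with c↦c inverse (from-to e-fixed) (from-to f-fixed) k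
  ...   | _ , c↦c′ with trans (sym (from-to a↦c)) c↦c′
  ...     | ()

  α : Fin (3 + n) → Fin (3 + n)
  α i = proj₁ (a↦a i)

  to-a : ∀ i → to (a i) ≡ a (α i)
  to-a i = proj₂ (a↦a i)

  γ : Fin (3 + n) → Fin (3 + n)
  γ i = proj₁ (c↦c iso e-fixed f-fixed i)

  to-c : ∀ i → to (c i) ≡ c (γ i)
  to-c i = proj₂ (c↦c iso e-fixed f-fixed i)

  α-index : ∀ {i j} → to (a i) ≡ a j → α i ≡ j
  α-index {i} eq = a-injective (trans (sym (to-a i)) eq)

  α-injective : ∀ {i j} → α i ≡ α j → i ≡ j
  α-injective {i} {j} eq = a-injective (preimage-unique (trans (to-a i) (cong a eq)) (to-a j))

  γ-injective : ∀ {i j} → γ i ≡ γ j → i ≡ j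
  γ-injective {i} {j} eq = c-injective (preimage-unique (trans (to-c i) (cong c eq)) (to-c j))

  b↦b : ∀ i → ∃[ j ] to (b i) ≡ b j
  b↦b i with distinct-others i | neighbour-of-e (preserves-at e-fixed refl (inj₁ eb))
  ... | _ | inj₁ b↦f with preimage-unique b↦f f-fixed
  ...   | ()
  b↦b i | j , _ , _ , j≢i , _ | inj₂ (inj₁ b↦g) =
    ⊥-elim (g≁a (preserves-at b↦g (to-a j) (inj₂ (ab j≢i))))
  b↦b i | _ | inj₂ (inj₂ (inj₁ b↦b′)) = b↦b′
  b↦b i | j , k , j≢k , j≢i , k≢i | inj₂ (inj₂ (inj₂ (m , b↦d))) =
    ⊥-elim (j≢k (α-injective (unique-a-neighbour (a~d j≢i) (a~d k≢i))))
    where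
      a~d : ∀ {l} → l ≢ i → Adj π′ (a (α l)) (d m)
      a~d l≢i = preserves-at (to-a _) b↦d (inj₁ (ab l≢i))

  d↦d : ∀ i → ∃[ j ] to (d i) ≡ d j
  d↦d i with distinct-others i | neighbour-of-e (preserves-at e-fixed refl (inj₁ ed))
  ... | _ | inj₁ d↦f with preimage-unique d↦f f-fixed
  ...   | ()
  d↦d i | _ | inj₂ (inj₁ d↦g) =
    ⊥-elim (g≁a (preserves-at d↦g (to-a _) (Sum.swap (a-neighbour-of-d i))))
  d↦d i | j , k , j≢k , j≢i , k≢i | inj₂ (inj₂ (inj₁ (m , d↦b))) =
    ⊥-elim (j≢k (γ-injective (unique-c-neighbour (c~b j≢i) (c~b k≢i))))
    where
      c~b : ∀ {l} → l ≢ i → Adj π′ (c (γ l)) (b m)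
      c~b l≢i = preserves-at (to-c _) d↦b (inj₁ (cd l≢i))
  d↦d i | _ | inj₂ (inj₂ (inj₂ d↦d′)) = d↦d′

  β : Fin (3 + n) → Fin (3 + n)
  β i = proj₁ (b↦b i)

  to-b : ∀ i → to (b i) ≡ b (β i)
  to-b i = proj₂ (b↦b i)

  δ : Fin (3 + n) → Fin (3 + n)
  δ i = proj₁ (d↦d i)

  to-d : ∀ i → to (d i) ≡ d (δ i)
  to-d i = proj₂ (d↦d i)

  α≡β : ∀ i → α i ≡ β i
  α≡β i = decidable-stable (α i ≟ β i) λ α≢β →
    a≁b (reflects-at (to-a i) (to-b i) (inj₁ (ab α≢β)))

  β≡γ : ∀ i → β i ≡ γ i
  β≡γ i = b-c-adjacent (preserves-at (to-b i) (to-c i) (inj₁ bc))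

  γ≡δ : ∀ i → γ i ≡ δ i
  γ≡δ i = decidable-stable (γ i ≟ δ i) λ γ≢δ →
    c≁d (reflects-at (to-c i) (to-d i) (inj₁ (cd γ≢δ)))

  α-conjugates : ∀ i → π′ ⟨$⟩ʳ α i ≡ α (π ⟨$⟩ʳ i)
  α-conjugates i = begin
    π′ ⟨$⟩ʳ α i   ≡⟨ a-d-adjacent (preserves-at (to-a i) (to-d (π ⟨$⟩ʳ i)) (inj₁ ad)) ⟩
    δ (π ⟨$⟩ʳ i)  ≡⟨ sym (γ≡δ _) ⟩
    γ (π ⟨$⟩ʳ i)  ≡⟨ sym (β≡γ _) ⟩
    β (π ⟨$⟩ʳ i)  ≡⟨ sym (α≡β _) ⟩
    α (π ⟨$⟩ʳ i)  ∎
    where open ≡-Reasoning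

isomorphic⇒conjugate : ∀ {n} {π π′ : Permutation′ (3 + n)} → Isomorphic π π′ → Conjugate π π′
isomorphic⇒conjugate {π = π} {π′} (φ , adjacency) =
  permutation α Inv.α (λ i → α-index (to-from (Inv.to-a i)))
                      (λ i → Inv.α-index (from-to (to-a i))) ,
  α-conjugates
  where
    iso : IsIsomorphism (Adj π) (Adj π′) φ
    iso = record { adjacency = adjacency }
    open Isomorphism iso
    fixed = hubs-fixed iso zero
    open IndexMaps iso (proj₁ fixed) (proj₂ fixed)
    module Inv = IndexMaps inverse (from-to (proj₁ fixed)) (from-to (proj₂ fixed))

relabel : ∀ {n} → Permutation′ n → Vertex n → Vertex n
relabel σ (a i) = a (σ ⟨$⟩ʳ i)
relabel σ (b i) = b (σ ⟨$⟩ʳ i)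
relabel σ (c i) = c (σ ⟨$⟩ʳ i)
relabel σ (d i) = d (σ ⟨$⟩ʳ i)
relabel σ e     = e
relabel σ f     = f
relabel σ g     = g

relabel-flip : ∀ {n} (σ : Permutation′ n) u → relabel σ (relabel (flip σ) u) ≡ u
relabel-flip σ (a i) = cong a (inverseʳ σ)
relabel-flip σ (b i) = cong b (inverseʳ σ)
relabel-flip σ (c i) = cong c (inverseʳ σ)
relabel-flip σ (d i) = cong d (inverseʳ σ)
relabel-flip σ e     = refl
relabel-flip σ f     = refl
relabel-flip σ g     = refl

relabelling : ∀ {n} → Permutation′ n → Vertex n ↔ Vertex n
relabelling σ = mk↔ₛ′ (relabel σ) (relabel (flip σ)) (relabel-flip σ) (relabel-flip (flip σ))

relabel-edge : ∀ {n} {π π′ : Permutation′ n} ((σ , _) : Conjugate π π′) {u v} →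
               Edge π u v → Edge π′ (relabel σ u) (relabel σ v)
relabel-edge (σ , _) (ab i≢j) = ab (i≢j ∘ Injection.injective (↔⇒↣ σ))
relabel-edge _       bc       = bc
relabel-edge (σ , _) (cd i≢j) = cd (i≢j ∘ Injection.injective (↔⇒↣ σ))
relabel-edge {π′ = π′} (σ , conj) (ad {i}) =
  subst (λ j → Edge π′ (a (σ ⟨$⟩ʳ i)) (d j)) (conj i) ad
relabel-edge _       eb       = eb
relabel-edge _       ed       = ed
relabel-edge _       ef       = ef
relabel-edge _       eg       = eg
relabel-edge _       fa       = fa
relabel-edge _       fc       = fc
relabel-edge _       gc       = gc

relabel-adjacent : ∀ {n} {π π′ : Permutation′ n} ((σ , _) : Conjugate π π′) {u v} →
                   Adj π u v → Adj π′ (relabel σ u) (relabel σ v)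
relabel-adjacent conj = Sum.map (relabel-edge conj) (relabel-edge conj)

conjugate-sym : ∀ {n} {π π′ : Permutation′ n} → Conjugate π π′ → Conjugate π′ π
conjugate-sym {π = π} {π′} (σ , conj) = flip σ , λ j → begin
  π ⟨$⟩ʳ (σ ⟨$⟩ˡ j)                        ≡⟨ sym (inverseˡ σ) ⟩
  σ ⟨$⟩ˡ (σ ⟨$⟩ʳ (π ⟨$⟩ʳ (σ ⟨$⟩ˡ j)))       ≡⟨ cong (σ ⟨$⟩ˡ_) (sym (conj (σ ⟨$⟩ˡ j))) ⟩
  σ ⟨$⟩ˡ (π′ ⟨$⟩ʳ (σ ⟨$⟩ʳ (σ ⟨$⟩ˡ j)))      ≡⟨ cong (λ k → σ ⟨$⟩ˡ (π′ ⟨$⟩ʳ k)) (inverseʳ σ) ⟩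
  σ ⟨$⟩ˡ (π′ ⟨$⟩ʳ j)                       ∎
  where open ≡-Reasoning

conjugate⇒isomorphic : ∀ {n} {π π′ : Permutation′ n} → Conjugate π π′ → Isomorphic π π′
conjugate⇒isomorphic {π = π} {π′} conj@(σ , _) = relabelling σ , IsIsomorphism.adjacency
  (isIsomorphism (relabelling σ) (relabel-adjacent conj)
                 (relabel-adjacent (conjugate-sym {π = π} {π′} conj)))

corollary17 : (n : ℕ) → n ≥ 3 → (π₁ π₂ : Permutation′ n) →
    Isomorphic π₁ π₂ ⇔ Conjugate π₁ π₂
corollary17 .(3 + n) (s≤s (s≤s (s≤s {n = n} z≤n))) π₁ π₂ =
  mk⇔ isomorphic⇒conjugate conjugate⇒isomorphic
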